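{- Let $H$ be a square-free graph, $W=\gamma_0\gamma_1\cdots\gamma_k$, $k\ge1$, an nc-walk in $H$, and $\mathcal K$ the edge gadget of $W$. For any $\omega_s\in N_H(\gamma_0)\setminus\{\gamma_1\}$ and $\omega_t\in N_H(\gamma_k)\setminus\{\gamma_{k-1}\}$: (1) $|\mathsf{Hom}((\mathcal K,s,t),(H,\omega_s,\omega_t))|=0$; (2) $|\mathsf{Hom}((\mathcal K,s,t),(H,\gamma_1,\omega_t))|=1$; (3) $|\mathsf{Hom}((\mathcal K,s,t),(H,\omega_s,\gamma_{k-1}))|=1$; (4) $|\mathsf{Hom}((\mathcal K,s,t),(H,\gamma_1,\gamma_{k-1}))|=1+\sum_{i=1}^{k-1}(\deg(\gamma_i)-1)$.
   Context: Graphs are finite, undirected, loopless, without parallel edges; square-free means no cycle of length 4; $N_H(v)$ is the neighbourhood and $\deg(v)$ the degree of $v$. An nc-walk is a walk $\gamma_0\cdots\gamma_k$ with $\gamma_{i-1}\ne\gamma_{i+1}$ for all $i\in\{1,\dots,k-1\}$. A partial $H$-labelled graph is a graph with a partial pinning function to $V(H)$; its homomorphisms to $H$ are graph homomorphisms extending the pinning; $\mathsf{Hom}((\mathcal G,x_1,\dots,x_r),(H,y_1,\dots,y_r))$ is the set of those additionally mapping $x_i$ to $y_i$. The edge gadget $\mathcal K=(K,\tau)$ of $W$: $K$ is a path $s\,v_1\cdots v_{k-1}\,t$ (the edge $st$ if $k=1$) plus vertices $u_1,\dots,u_{k-1}$ with edges $v_iu_i$; pinning $\tau(u_i)=\gamma_i$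 for $i\in\{1,\dots,k-1\}$. -}

module Defs where

open import Data.Nat using (ℕ; zero; suc; _+_; _∸_)
open import Data.Bool using (Bool; true; false; T)
open import Data.Fin using (Fin; zero; suc; inject₁; fromℕ)
open import Data.List using (List; length; filterᵇ; allFin)
open import Data.Maybe using (Maybe; just; nothing)
open import Data.Product using (Σ; ∃; _×_; _,_)
open import Data.Empty using (⊥)
open import Relation.Binary.PropositionalEquality using (_≡_; _≢_)

record Graph : Set where
  field
    n      : ℕ
    adj    : Fin n → Fin n → Bool
    sym    : ∀ x y → adj x y ≡ adj y x
    irrefl : ∀ x → adj x x ≡ false

module _ (H : Graph) where
  open Graph H

  Adj : Fin n → Fin n → Set
  Adj x y = T (adj x y)

  nbrs : Fin n → List (Fin n)
  nbrs v = filterᵇ (adj v) (allFin n)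

  deg : Fin n → ℕ
  deg v = length (nbrs v)

  -- no cycle of length 4: a b c d a with a ≠ c, b ≠ d
  -- (a ≠ b, b ≠ c, c ≠ d, d ≠ a follow from looplessness)
  SquareFree : Set
  SquareFree = ∀ a b c d → Adj a b → Adj b c → Adj c d → Adj d a →
               a ≢ c → b ≢ d → ⊥

  IsWalk : (k : ℕ) → (Fin (suc k) → Fin n) → Set
  IsWalk k γ = ∀ (i : Fin k) → Adj (γ (inject₁ i)) (γ (suc i))

  -- nc-walk γ_0 … γ_{m+1}: a walk with γ_{i-1} ≠ γ_{i+1} for 1 ≤ i ≤ m
  IsNcWalk : (m : ℕ) → (Fin (suc (suc m)) → Fin n) → Set
  IsNcWalk m γ = IsWalk (suc m) γ ×
                 (∀ (i : Fin m) → γ (inject₁ (inject₁ i)) ≢ γ (suc (suc i)))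

record PLGraph (H : Graph) : Set₁ where
  field
    Vtx  : Set
    Edge : Vtx → Vtx → Set                 -- symmetric edge relation
    pin  : Vtx → Maybe (Fin (Graph.n H))

module _ {H : Graph} (G : PLGraph H) where
  open PLGraph G

  IsHom : (Vtx → Fin (Graph.n H)) → Set
  IsHom h = (∀ x y → Edge x y → Adj H (h x) (h y)) ×
            (∀ x c → pin x ≡ just c → h x ≡ c)

  IsHom₂ : Vtx → Vtx → Fin (Graph.n H) → Fin (Graph.n H) →
           (Vtx → Fin (Graph.n H)) → Set
  IsHom₂ x₁ x₂ y₁ y₂ h = IsHom h × h x₁ ≡ y₁ × h x₂ ≡ y₂

-- Cardinality of a set of maps {h : A → B | P h}, maps compared
-- extensionally (pointwise): there is an enumeration by Fin m that is
-- injective, lands in P and hits every element of P.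

_≗_ : {A B : Set} → (A → B) → (A → B) → Set
f ≗ g = ∀ x → f x ≡ g x

CardMaps : {A B : Set} → ((A → B) → Set) → ℕ → Set
CardMaps {A} {B} P m =
  Σ (Fin m → A → B) λ e →
    (∀ i j → e i ≗ e j → i ≡ j) ×
    (∀ i → P (e i)) ×
    (∀ h → P h → ∃ λ i → e i ≗ h)

-- Edge gadget of a walk W = γ_0 … γ_k with k = suc m ≥ 1.
-- Vertices: path vertices p 0 = s, p i = v_i (1 ≤ i ≤ k-1), p k = t,
-- and pendant vertices u j = u_{j+1} (0 ≤ j ≤ m-1, i.e. u_1 … u_{k-1}).

data GV (m : ℕ) : Set where
  p : Fin (suc (suc m)) → GV m
  u : Fin m → GV m

data GE (m : ℕ) : GV m → GV m → Set where
  path  : ∀ (i : Fin (suc m)) → GE m (p (inject₁ i)) (p (suc i))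
  path' : ∀ (i : Fin (suc m)) → GE m (p (suc i)) (p (inject₁ i))
  pend  : ∀ (j : Fin m) → GE m (p (suc (inject₁ j))) (u j)
  pend' : ∀ (j : Fin m) → GE m (u j) (p (suc (inject₁ j)))

module _ (H : Graph) (m : ℕ) (γ : Fin (suc (suc m)) → Fin (Graph.n H)) where

  gpin : GV m → Maybe (Fin (Graph.n H))
  gpin (p _) = nothing
  gpin (u j) = just (γ (suc (inject₁ j)))

  edgeGadget : PLGraph H
  edgeGadget = record { Vtx = GV m ; Edge = GE m ; pin = gpin }

  gs gt : GV m
  gs = p zero
  gt = p (fromℕ (suc m))

-- A homomorphism of the edge gadget is determined by its values x₀ … x_k on
-- the path, a walk with x_i ∼ γ_i for 0 < i < k.  If x_{i-1} is a neighbour of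
-- γ_{i-1} other than γ_i, then x_i is a common neighbour of x_{i-1} and γ_i, as
-- is γ_{i-1}; square-freeness forces x_i = γ_{i-1}, and as γ_{i-1} ≠ γ_{i+1}
-- this situation repeats.  So a walk that starts "behind" (at ω_s) stays behind and
-- ends at γ_{k-1}, and a walk that ends "ahead" (at ω_t) was ahead all along,
-- i.e. x_i = γ_{i+1}.  A walk from γ₁ to γ_{k-1} either stays ahead up to
-- γ_{k-1}, or falls behind exactly once, at a step i where it picks one of the
-- deg(γ_i) − 1 neighbours of γ_i other than γ_{i+1}.
module Submission where

open import Defs
open import Data.Nat using (ℕ; zero; suc; _+_; _∸_)
open import Data.Nat.Properties using (+-comm)
open import Data.Nat.ListAction using (sum)
open import Data.Fin using (Fin; zero; suc; inject₁; fromℕ; _≟_; splitAt; _↑ˡ_; _↑ʳ_)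
open import Data.Fin.Properties using (splitAt-↑ˡ; splitAt-↑ʳ; splitAt⁻¹-↑ˡ; splitAt⁻¹-↑ʳ)
import Data.Vec.Functional as Vec
open import Data.List using (List; []; _∷_; map; allFin; length; filter)
open import Data.List.Properties using (map-tabulate; filter-accept; filter-reject; filter-all)
import Data.List.Relation.Unary.All as All
open import Data.List.Relation.Unary.AllPairs using (_∷_)
open import Data.List.Relation.Unary.Any using (here; there)
open import Data.List.Relation.Unary.Unique.Propositional using (Unique)
open import Data.List.Relation.Unary.Unique.Propositional.Properties using (filter⁺; allFin⁺)
open import Data.List.Membership.Propositional using (_∈_)
open import Data.List.Membership.Propositional.Properties using (∈-filter⁺; ∈-filter⁻; ∈-allFin)
open import Data.Bool using (T)
open import Data.Bool.Properties using (T?)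
open import Data.Sum using (_⊎_; inj₁; inj₂)
open import Data.Product using (∃; _×_; _,_; proj₁; proj₂)
open import Data.Empty using (⊥-elim)
open import Relation.Nullary using (¬_; yes; no)
open import Relation.Nullary.Decidable using (¬?)
open import Relation.Binary.PropositionalEquality
  using (_≡_; _≢_; refl; sym; trans; cong; subst; subst₂; module ≡-Reasoning)

module _ {A B : Set} where

  card-∅ : {P : (A → B) → Set} → (∀ h → ¬ P h) → CardMaps P 0
  card-∅ ¬P = (λ ()) , (λ ()) , (λ ()) , λ h ph → ⊥-elim (¬P h ph)

  card-singleton : {P : (A → B) → Set} (h₀ : A → B) → P h₀ → (∀ h → P h → h₀ ≗ h) →
                   CardMaps P 1
  card-singleton h₀ ph₀ unique =
    (λ _ → h₀) , (λ { zero zero _ → refl }) , (λ _ → ph₀) , λ h ph → zero , unique h ph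

  card-cong : {P Q : (A → B) → Set} {c : ℕ} → (∀ h → P h → Q h) → (∀ h → Q h → P h) →
              CardMaps P c → CardMaps Q c
  card-cong P⇒Q Q⇒P (e , inj , ∈P , onto) =
    e , inj , (λ i → P⇒Q _ (∈P i)) , λ h qh → onto h (Q⇒P h qh)

  card-⊎ : {P Q : (A → B) → Set} {a b : ℕ} → CardMaps P a → CardMaps Q b →
           (∀ f g → P f → Q g → ¬ f ≗ g) → CardMaps (λ h → P h ⊎ Q h) (a + b)
  card-⊎ {P} {Q} {a} {b} (e₁ , inj₁ᵉ , ∈P , onto₁) (e₂ , inj₂ᵉ , ∈Q , onto₂) disjoint =
    e , inj , ∈P⊎Q , onto
    where
    e⊎ : Fin a ⊎ Fin b → A → B
    e⊎ (inj₁ i) = e₁ i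
    e⊎ (inj₂ i) = e₂ i

    e : Fin (a + b) → A → B
    e i = e⊎ (splitAt a i)

    ∈P⊎Q : ∀ i → P (e i) ⊎ Q (e i)
    ∈P⊎Q i with splitAt a i
    ... | inj₁ j = inj₁ (∈P j)
    ... | inj₂ j = inj₂ (∈Q j)

    inj : ∀ i j → e i ≗ e j → i ≡ j
    inj i j eq with splitAt a i in si | splitAt a j in sj
    ... | inj₁ x | inj₁ y =
      trans (sym (splitAt⁻¹-↑ˡ si)) (trans (cong (_↑ˡ b) (inj₁ᵉ x y eq)) (splitAt⁻¹-↑ˡ sj))
    ... | inj₂ x | inj₂ y =
      trans (sym (splitAt⁻¹-↑ʳ si)) (trans (cong (a ↑ʳ_) (inj₂ᵉ x y eq)) (splitAt⁻¹-↑ʳ sj))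
    ... | inj₁ x | inj₂ y = ⊥-elim (disjoint _ _ (∈P x) (∈Q y) eq)
    ... | inj₂ x | inj₁ y = ⊥-elim (disjoint _ _ (∈P y) (∈Q x) (λ z → sym (eq z)))

    onto : ∀ h → P h ⊎ Q h → ∃ λ i → e i ≗ h
    onto h (inj₁ ph) with onto₁ h ph
    ... | i , eq = i ↑ˡ b , λ z → trans (cong (λ s → e⊎ s z) (splitAt-↑ˡ a i b)) (eq z)
    onto h (inj₂ qh) with onto₂ h qh
    ... | i , eq = a ↑ʳ i , λ z → trans (cong (λ s → e⊎ s z) (splitAt-↑ʳ a b i)) (eq z)

card-⋃-singletons : {A B V : Set} (L : List V) → Unique L → (F : V → (A → B) → Set) →
  (∀ v → v ∈ L → CardMaps (F v) 1) → (∀ v w f g → F v f → F w g → f ≗ g → v ≡ w) →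
  CardMaps (λ h → ∃ λ v → v ∈ L × F v h) (length L)
card-⋃-singletons [] _ F _ _ = card-∅ λ { h (v , () , _) }
card-⋃-singletons (x ∷ xs) (x∉xs ∷ uxs) F single disjoint =
  card-cong merge split
    (card-⊎ (single x (here refl))
            (card-⋃-singletons xs uxs F (λ v v∈xs → single v (there v∈xs)) disjoint)
            (λ { f g fx (v , v∈xs , gv) eq → All.lookup x∉xs v∈xs (disjoint x v f g fx gv eq) }))
  where
  merge : ∀ h → F x h ⊎ (∃ λ v → v ∈ xs × F v h) → ∃ λ v → v ∈ x ∷ xs × F v h
  merge h (inj₁ fx) = x , here refl , fx
  merge h (inj₂ (v , v∈xs , fv)) = v , there v∈xs , fv

  split : ∀ h → (∃ λ v → v ∈ x ∷ xs × F v h) → F x h ⊎ (∃ λ v → v ∈ xs × F v h)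
  split h (v , here refl , fv) = inj₁ fv
  split h (v , there v∈xs , fv) = inj₂ (v , v∈xs , fv)

card-transport : {A A′ B : Set} {Q : (A′ → B) → Set} {P : (A → B) → Set} {c : ℕ} →
  (Φ : (A′ → B) → (A → B)) (ψ : (A → B) → (A′ → B)) →
  (∀ x → Q x → P (Φ x)) → (∀ h → P h → Q (ψ h)) → (∀ h → P h → Φ (ψ h) ≗ h) →
  (∀ x y → Φ x ≗ Φ y → x ≗ y) → (∀ x y → x ≗ y → Φ x ≗ Φ y) →
  CardMaps Q c → CardMaps P c
card-transport Φ ψ Q⇒P P⇒Q Φψ≗id reflects preserves (e , inj , ∈Q , onto) =
  (λ i → Φ (e i)) , (λ i j eq → inj i j (reflects _ _ eq)) , (λ i → Q⇒P _ (∈Q i)) ,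
  λ h ph → let (i , eq) = onto (ψ h) (P⇒Q h ph) in
           i , λ z → trans (preserves _ _ eq z) (Φψ≗id h ph z)

length-filter-≢ : {n : ℕ} (w : Fin n) (xs : List (Fin n)) → Unique xs → w ∈ xs →
  suc (length (filter (λ x → ¬? (x ≟ w)) xs)) ≡ length xs
length-filter-≢ w (x ∷ xs) (x∉xs ∷ _) (here refl)
  rewrite filter-reject (λ x → ¬? (x ≟ w)) {x} {xs} (λ x≢x → x≢x refl)
        | filter-all (λ x → ¬? (x ≟ w)) (All.map (λ x≢y y≡x → x≢y (sym y≡x)) x∉xs) = refl
length-filter-≢ w (x ∷ xs) (x∉xs ∷ uxs) (there w∈xs)
  rewrite filter-accept (λ x → ¬? (x ≟ w)) {x} {xs} (All.lookup x∉xs w∈xs) =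
  cong suc (length-filter-≢ w xs uxs w∈xs)

module _ (H : Graph) where
  open Graph H using (n; adj)

  Adj-sym : ∀ {x y} → Adj H x y → Adj H y x
  Adj-sym {x} {y} = subst T (Graph.sym H x y)

  IsNcWalk-tail : ∀ m γ → IsNcWalk H (suc m) γ → IsNcWalk H m (Vec.tail γ)
  IsNcWalk-tail m γ (walk , nc) = (λ i → walk (suc i)) , (λ i → nc (suc i))

  -- The restriction to the path of a homomorphism of the edge gadget of γ
  -- sending s to a and t to b.
  PinnedWalk : (m : ℕ) → Vec.Vector (Fin n) (suc (suc m)) → Fin n → Fin n →
               Vec.Vector (Fin n) (suc (suc m)) → Set
  PinnedWalk zero    γ a b x = x zero ≡ a × x (suc zero) ≡ b × Adj H a b
  PinnedWalk (suc m) γ a b x =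
    x zero ≡ a × Adj H a (x (suc zero)) × Adj H (x (suc zero)) (γ (suc zero)) ×
    PinnedWalk m (Vec.tail γ) (x (suc zero)) b (Vec.tail x)

  PinnedWalk-head : ∀ m γ {a b} x → PinnedWalk m γ a b x → x zero ≡ a
  PinnedWalk-head zero    γ x (x₀≡a , _) = x₀≡a
  PinnedWalk-head (suc m) γ x (x₀≡a , _) = x₀≡a

  PinnedWalk-cons : ∀ m γ {a b v} x → Adj H a v → Adj H v (γ (suc zero)) →
    PinnedWalk m (Vec.tail γ) v b x → PinnedWalk (suc m) γ a b (a Vec.∷ x)
  PinnedWalk-cons zero    γ x av vγ w@(refl , _) = refl , av , vγ , w
  PinnedWalk-cons (suc m) γ x av vγ w@(refl , _) = refl , av , vγ , w

  card-PinnedWalk-zero : ∀ γ {a b} → Adj H a b → CardMaps (PinnedWalk zero γ a b) 1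
  card-PinnedWalk-zero γ {a} {b} ab =
    card-singleton (a Vec.∷ b Vec.∷ Vec.[]) (refl , refl , ab)
      (λ { h (h₀≡a , _) zero → sym h₀≡a ; h (_ , h₁≡b , _) (suc zero) → sym h₁≡b })

  card-PinnedWalk-second : ∀ m γ {a b v c} → Adj H a v → Adj H v (γ (suc zero)) →
    CardMaps (PinnedWalk m (Vec.tail γ) v b) c →
    CardMaps (λ h → PinnedWalk (suc m) γ a b h × h (suc zero) ≡ v) c
  card-PinnedWalk-second m γ {a} av vγ =
    card-transport (a Vec.∷_) Vec.tail
      (λ x w → PinnedWalk-cons m γ x av vγ w , PinnedWalk-head m _ x w)
      (λ { h ((_ , _ , _ , w) , refl) → w })
      (λ { h ((refl , _) , _) zero → refl ; h _ (suc i) → refl })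
      (λ x y eq i → eq (suc i))
      (λ { x y eq zero → refl ; x y eq (suc i) → eq i })

  PinnedWalk⇒adjacencies : ∀ m γ {a b} x → PinnedWalk m γ a b x →
    x (fromℕ (suc m)) ≡ b × (∀ i → Adj H (x (inject₁ i)) (x (suc i))) ×
    (∀ j → Adj H (x (suc (inject₁ j))) (γ (suc (inject₁ j))))
  PinnedWalk⇒adjacencies zero γ x (refl , refl , ab) = refl , (λ { zero → ab }) , λ ()
  PinnedWalk⇒adjacencies (suc m) γ x (refl , ax₁ , x₁γ₁ , w)
    with PinnedWalk⇒adjacencies m (Vec.tail γ) (Vec.tail x) w
  ... | end , steps , pendant =
    end , (λ { zero → ax₁ ; (suc i) → steps i }) , λ { zero → x₁γ₁ ; (suc j) → pendant j }

  adjacencies⇒PinnedWalk : ∀ m γ {a b} x → x zero ≡ a → x (fromℕ (suc m)) ≡ b →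
    (∀ i → Adj H (x (inject₁ i)) (x (suc i))) →
    (∀ j → Adj H (x (suc (inject₁ j))) (γ (suc (inject₁ j)))) → PinnedWalk m γ a b x
  adjacencies⇒PinnedWalk zero γ x start end steps pendant =
    start , end , subst₂ (Adj H) start end (steps zero)
  adjacencies⇒PinnedWalk (suc m) γ x refl end steps pendant =
    refl , steps zero , pendant zero ,
    adjacencies⇒PinnedWalk m (Vec.tail γ) (Vec.tail x) refl end
      (λ i → steps (suc i)) (λ j → pendant (suc j))

  extendToGadget : ∀ m → Vec.Vector (Fin n) (suc (suc m)) → Vec.Vector (Fin n) (suc (suc m)) →
                   GV m → Fin n
  extendToGadget m γ x (p i) = x i
  extendToGadget m γ x (u j) = γ (suc (inject₁ j))

  card-gadgetHoms : ∀ m γ a b {c} → CardMaps (PinnedWalk m γ a b) c →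
    CardMaps (IsHom₂ (edgeGadget H m γ) (gs H m γ) (gt H m γ) a b) c
  card-gadgetHoms m γ a b =
    card-transport (extendToGadget m γ) (λ h i → h (p i)) extend restrict
      (λ { h _ (p i) → refl ; h ((_ , pinned) , _) (u j) → sym (pinned (u j) _ refl) })
      (λ x y eq i → eq (p i))
      (λ { x y eq (p i) → eq i ; x y eq (u j) → refl })
    where
    extend : ∀ x → PinnedWalk m γ a b x →
             IsHom₂ (edgeGadget H m γ) (gs H m γ) (gt H m γ) a b (extendToGadget m γ x)
    extend x w with PinnedWalk⇒adjacencies m γ x w
    ... | end , steps , pendant =
      ((λ { _ _ (path i) → steps i ; _ _ (path' i) → Adj-sym (steps i)
          ; _ _ (pend j) → pendant j ; _ _ (pend' j) → Adj-sym (pendant j) }) ,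
       (λ { (p i) c () ; (u j) c refl → refl })) ,
      PinnedWalk-head m γ x w , end
    restrict : ∀ h → IsHom₂ (edgeGadget H m γ) (gs H m γ) (gt H m γ) a b h →
               PinnedWalk m γ a b (λ i → h (p i))
    restrict h ((edge , pinned) , start , end) =
      adjacencies⇒PinnedWalk m γ _ start end (λ i → edge _ _ (path i))
        (λ j → subst (Adj H _) (pinned (u j) _ refl) (edge _ _ (pend j)))

  otherNeighbours : Fin n → Fin n → List (Fin n)
  otherNeighbours v w = filter (λ x → ¬? (x ≟ w)) (nbrs H v)

  private
    nbrs-unique : ∀ v → Unique (nbrs H v)
    nbrs-unique v = filter⁺ (λ x → T? (adj v x)) (allFin⁺ n)

    ∈-nbrs⁺ : ∀ {v x} → Adj H v x → x ∈ nbrs H v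
    ∈-nbrs⁺ {v} {x} = ∈-filter⁺ (λ x → T? (adj v x)) (∈-allFin x)

  otherNeighbours-unique : ∀ v w → Unique (otherNeighbours v w)
  otherNeighbours-unique v w = filter⁺ (λ x → ¬? (x ≟ w)) (nbrs-unique v)

  ∈-otherNeighbours⁺ : ∀ {v w x} → Adj H v x → x ≢ w → x ∈ otherNeighbours v w
  ∈-otherNeighbours⁺ {w = w} vx x≢w = ∈-filter⁺ (λ x → ¬? (x ≟ w)) (∈-nbrs⁺ vx) x≢w

  ∈-otherNeighbours⁻ : ∀ {v w x} → x ∈ otherNeighbours v w → Adj H v x × x ≢ w
  ∈-otherNeighbours⁻ {v} {w} x∈ with ∈-filter⁻ (λ x → ¬? (x ≟ w)) {xs = nbrs H v} x∈
  ... | x∈nbrs , x≢w = proj₂ (∈-filter⁻ (λ x → T? (adj v x)) {xs = allFin n} x∈nbrs) , x≢w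

  length-otherNeighbours : ∀ {v w} → Adj H v w → length (otherNeighbours v w) ≡ deg H v ∸ 1
  length-otherNeighbours {v} {w} vw =
    cong (_∸ 1) (length-filter-≢ w (nbrs H v) (nbrs-unique v) (∈-nbrs⁺ vw))

  excessDegreeSum : ∀ m → Vec.Vector (Fin n) (suc (suc m)) → ℕ
  excessDegreeSum m γ = sum (map (λ j → deg H (γ (suc (inject₁ j))) ∸ 1) (allFin m))

  excessDegreeSum-suc : ∀ m γ →
    excessDegreeSum (suc m) γ ≡ (deg H (γ (suc zero)) ∸ 1) + excessDegreeSum m (Vec.tail γ)
  excessDegreeSum-suc m γ = cong (λ l → (deg H (γ (suc zero)) ∸ 1) + sum l)
    (trans (map-tabulate suc f) (sym (map-tabulate (λ i → i) (λ j → f (suc j)))))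
    where
    f : Fin (suc m) → ℕ
    f j = deg H (γ (suc (inject₁ j))) ∸ 1

module _ (H : Graph) (square-free : SquareFree H) where
  open Graph H using (n)

  common-neighbour-unique : ∀ {c a b x} → Adj H c a → Adj H c b → a ≢ b →
                            Adj H a x → Adj H x b → x ≡ c
  common-neighbour-unique {c} {a} {b} {x} ca cb a≢b ax xb with x ≟ c
  ... | yes x≡c = x≡c
  ... | no x≢c = ⊥-elim (square-free c a x b ca ax xb (Adj-sym H cb) (λ c≡x → x≢c (sym c≡x)) a≢b)

  no-walk-behind-ahead : ∀ m γ → IsNcWalk H m γ → ∀ {a b} →
    Adj H (γ zero) a → a ≢ γ (suc zero) →
    Adj H (γ (fromℕ (suc m))) b → b ≢ γ (inject₁ (fromℕ m)) →
    ∀ x → ¬ PinnedWalk H m γ a b x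
  no-walk-behind-ahead zero γ (walk , _) {a} {b} γ₀a a≢γ₁ γ₁b b≢γ₀ x (_ , _ , ab) =
    square-free (γ zero) a b (γ (suc zero)) γ₀a ab (Adj-sym H γ₁b) (Adj-sym H (walk zero))
      (λ γ₀≡b → b≢γ₀ (sym γ₀≡b)) a≢γ₁
  no-walk-behind-ahead (suc m) γ nc@(walk , nonBacktracking) γ₀a a≢γ₁ γ₁b b≢γ₀ x (_ , ax₁ , x₁γ₁ , w) =
    no-walk-behind-ahead m (Vec.tail γ) (IsNcWalk-tail H m γ nc)
      (Adj-sym H x₁γ₁) (λ x₁≡γ₂ → nonBacktracking zero (trans (sym x₁≡γ₀) x₁≡γ₂))
      γ₁b b≢γ₀ (Vec.tail x) w
    where
    x₁≡γ₀ : x (suc zero) ≡ γ zero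
    x₁≡γ₀ = common-neighbour-unique γ₀a (walk zero) a≢γ₁ ax₁ x₁γ₁

  card-walks-behind-behind : ∀ m γ → IsNcWalk H m γ → ∀ {a} →
    Adj H (γ zero) a → a ≢ γ (suc zero) →
    CardMaps (PinnedWalk H m γ a (γ (inject₁ (fromℕ m)))) 1
  card-walks-behind-behind zero γ _ γ₀a _ = card-PinnedWalk-zero H γ (Adj-sym H γ₀a)
  card-walks-behind-behind (suc m) γ nc@(walk , nonBacktracking) γ₀a a≢γ₁ =
    card-cong (λ _ → proj₁) (λ { h w@(_ , ah₁ , h₁γ₁ , _) →
                         w , common-neighbour-unique γ₀a (walk zero) a≢γ₁ ah₁ h₁γ₁ })
      (card-PinnedWalk-second H m γ (Adj-sym H γ₀a) (walk zero)
        (card-walks-behind-behind m (Vec.tail γ) (IsNcWalk-tail H m γ nc)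
          (Adj-sym H (walk zero)) (nonBacktracking zero)))

  card-walks-ahead-ahead : ∀ m γ → IsNcWalk H m γ → ∀ {b} →
    Adj H (γ (fromℕ (suc m))) b → b ≢ γ (inject₁ (fromℕ m)) →
    CardMaps (PinnedWalk H m γ (γ (suc zero)) b) 1
  card-walks-ahead-ahead zero γ _ γ₁b _ = card-PinnedWalk-zero H γ γ₁b
  card-walks-ahead-ahead (suc m) γ nc@(walk , _) γ₁b b≢γ₀ =
    card-cong (λ _ → proj₁) staysAhead
      (card-PinnedWalk-second H m γ (walk (suc zero)) (Adj-sym H (walk (suc zero)))
        (card-walks-ahead-ahead m (Vec.tail γ) (IsNcWalk-tail H m γ nc) γ₁b b≢γ₀))
    where
    staysAhead : ∀ h → PinnedWalk H (suc m) γ (γ (suc zero)) _ h →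
                 PinnedWalk H (suc m) γ (γ (suc zero)) _ h × h (suc zero) ≡ γ (suc (suc zero))
    staysAhead h w@(_ , γ₁h₁ , _ , rest) with h (suc zero) ≟ γ (suc (suc zero))
    ... | yes h₁≡γ₂ = w , h₁≡γ₂
    ... | no h₁≢γ₂ = ⊥-elim (no-walk-behind-ahead m (Vec.tail γ) (IsNcWalk-tail H m γ nc)
                               γ₁h₁ h₁≢γ₂ γ₁b b≢γ₀ (Vec.tail h) rest)

  card-walks-ahead-behind : ∀ m γ → IsNcWalk H m γ →
    CardMaps (PinnedWalk H m γ (γ (suc zero)) (γ (inject₁ (fromℕ m)))) (1 + excessDegreeSum H m γ)
  card-walks-ahead-behind zero γ (walk , _) = card-PinnedWalk-zero H γ (Adj-sym H (walk zero))
  card-walks-ahead-behind (suc m) γ nc@(walk , _) =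
    subst (CardMaps _) count (card-cong merge split (card-⊎ staysAhead fallsBehind disjoint))
    where
    γ₁ γ₂ : Fin n
    γ₁ = γ (suc zero)
    γ₂ = γ (suc (suc zero))

    γ₁γ₂ : Adj H γ₁ γ₂
    γ₁γ₂ = walk (suc zero)

    nc′ : IsNcWalk H m (Vec.tail γ)
    nc′ = IsNcWalk-tail H m γ nc

    others : List (Fin n)
    others = otherNeighbours H γ₁ γ₂

    Walk : (Fin (suc (suc (suc m))) → Fin n) → Set
    Walk = PinnedWalk H (suc m) γ γ₁ (γ (inject₁ (fromℕ (suc m))))

    Second : Fin n → (Fin (suc (suc (suc m))) → Fin n) → Set
    Second v h = Walk h × h (suc zero) ≡ v

    staysAhead : CardMaps (Second γ₂) (1 + excessDegreeSum H m (Vec.tail γ))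
    staysAhead = card-PinnedWalk-second H m γ γ₁γ₂ (Adj-sym H γ₁γ₂)
                   (card-walks-ahead-behind m (Vec.tail γ) nc′)

    fallsBehind : CardMaps (λ h → ∃ λ v → v ∈ others × Second v h) (length others)
    fallsBehind = card-⋃-singletons others (otherNeighbours-unique H γ₁ γ₂) Second
      (λ v v∈others → let (γ₁v , v≢γ₂) = ∈-otherNeighbours⁻ H v∈others in
        card-PinnedWalk-second H m γ γ₁v (Adj-sym H γ₁v)
          (card-walks-behind-behind m (Vec.tail γ) nc′ γ₁v v≢γ₂))
      (λ v w f g (_ , f₁≡v) (_ , g₁≡w) f≗g → trans (sym f₁≡v) (trans (f≗g (suc zero)) g₁≡w))

    disjoint : ∀ f g → Second γ₂ f → (∃ λ v → v ∈ others × Second v g) → ¬ f ≗ g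
    disjoint f g (_ , f₁≡γ₂) (v , v∈others , _ , g₁≡v) f≗g =
      proj₂ (∈-otherNeighbours⁻ H v∈others) (trans (sym g₁≡v) (trans (sym (f≗g (suc zero))) f₁≡γ₂))

    merge : ∀ h → Second γ₂ h ⊎ (∃ λ v → v ∈ others × Second v h) → Walk h
    merge h (inj₁ (w , _)) = w
    merge h (inj₂ (_ , _ , w , _)) = w

    split : ∀ h → Walk h → Second γ₂ h ⊎ (∃ λ v → v ∈ others × Second v h)
    split h w@(_ , γ₁h₁ , _) with h (suc zero) ≟ γ₂
    ... | yes h₁≡γ₂ = inj₁ (w , h₁≡γ₂)
    ... | no h₁≢γ₂ = inj₂ (h (suc zero) , ∈-otherNeighbours⁺ H γ₁h₁ h₁≢γ₂ , w , refl)

    count : (1 + excessDegreeSum H m (Vec.tail γ)) + length others ≡ 1 + excessDegreeSum H (suc m) γ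
    count = cong suc (begin
      excessDegreeSum H m (Vec.tail γ) + length others
        ≡⟨ +-comm (excessDegreeSum H m (Vec.tail γ)) (length others) ⟩
      length others + excessDegreeSum H m (Vec.tail γ)
        ≡⟨ cong (_+ excessDegreeSum H m (Vec.tail γ)) (length-otherNeighbours H γ₁γ₂) ⟩
      (deg H γ₁ ∸ 1) + excessDegreeSum H m (Vec.tail γ)
        ≡⟨ sym (excessDegreeSum-suc H m γ) ⟩
      excessDegreeSum H (suc m) γ ∎)
      where open ≡-Reasoning

lemma4 : (H : Graph) → SquareFree H →
    (m : ℕ) (γ : Fin (suc (suc m)) → Fin (Graph.n H)) → IsNcWalk H m γ →
    (ωs ωt : Fin (Graph.n H)) →
    Adj H (γ zero) ωs → ωs ≢ γ (suc zero) →
    Adj H (γ (fromℕ (suc m))) ωt → ωt ≢ γ (inject₁ (fromℕ m)) →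
    CardMaps (IsHom₂ (edgeGadget H m γ) (gs H m γ) (gt H m γ) ωs ωt) 0
    × CardMaps (IsHom₂ (edgeGadget H m γ) (gs H m γ) (gt H m γ) (γ (suc zero)) ωt) 1
    × CardMaps (IsHom₂ (edgeGadget H m γ) (gs H m γ) (gt H m γ) ωs (γ (inject₁ (fromℕ m)))) 1
    × CardMaps (IsHom₂ (edgeGadget H m γ) (gs H m γ) (gt H m γ) (γ (suc zero)) (γ (inject₁ (fromℕ m))))
        (1 + sum (map (λ j → deg H (γ (suc (inject₁ j))) ∸ 1) (allFin m)))
lemma4 H square-free m γ nc ωs ωt γ₀ωs ωs≢γ₁ γₖωt ωt≢γₖ₋₁ =
  card-gadgetHoms H m γ ωs ωt
    (card-∅ (no-walk-behind-ahead H square-free m γ nc γ₀ωs ωs≢γ₁ γₖωt ωt≢γₖ₋₁)) ,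
  card-gadgetHoms H m γ _ ωt (card-walks-ahead-ahead H square-free m γ nc γₖωt ωt≢γₖ₋₁) ,
  card-gadgetHoms H m γ ωs _ (card-walks-behind-behind H square-free m γ nc γ₀ωs ωs≢γ₁) ,
  card-gadgetHoms H m γ _ _ (card-walks-ahead-behind H square-free m γ nc)
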